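{- For every concept $C\in\mathcal{L}(\geq,\sqcap,\top)$, every interpretation $\mathcal I$ and every $d\in C^{\mathcal I}$, there is a sub-interpretation $\mathcal I'\subseteq\mathcal I$ with $d\in C^{\mathcal I'}$ and $|\Delta^{\mathcal I'}|\leq |C|^{|C|}$.
   Context: $\mathcal{L}(\geq,\sqcap,\top)$ is the set of concepts $C ::= A\mid\top\mid C\sqcap C\mid(\geq k\,R.C)$ with $A$ a concept name, $R$ a role name, $k\ge1$, standard semantics ($\geq k\,R.C$: at least $k$ pairwise distinct $R$-successors in $C$); $|C|$ is the number of symbols in $C$. $\mathcal I'\subseteq\mathcal I$ means $\Delta^{\mathcal I'}\subseteq\Delta^{\mathcal I}$ and $X^{\mathcal I'}\subseteq X^{\mathcal I}$ for every concept and role name $X$. -}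

module Defs where

open import Data.Nat using (ℕ; suc; _+_; _^_; _≤_)
open import Data.List using (List; length)
open import Data.List.Relation.Unary.All using (All)
open import Data.List.Relation.Unary.Unique.Propositional using (Unique)
open import Data.List.Membership.Propositional using (_∈_)
open import Data.Product using (_×_; Σ; ∃)
open import Data.Unit using (⊤)
open import Relation.Binary.PropositionalEquality using (_≡_)

ConceptName : Set
ConceptName = ℕ

RoleName : Set
RoleName = ℕ

data Concept : Set where
  atom  : ConceptName → Concept
  top   : Concept
  _⊓_   : Concept → Concept → Concept
  atLeast : (k : ℕ) → 1 ≤ k → RoleName → Concept → Concept

-- Size |C| = number of symbols; the number k is written in unary (k symbols),
-- and ≥ and R count one symbol each.
size : Concept → ℕ
size (atom A) = 1
size top = 1
size (C ⊓ D) = size C + size D + 1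
size (atLeast k _ R C) = 1 + k + 1 + size C

record Interp : Set₁ where
  field
    Δ    : Set
    conI : ConceptName → Δ → Set
    rolI : RoleName → Δ → Δ → Set
open Interp public

sem : {D : Set} → (dom : D → Set) → (ConceptName → D → Set) →
      (RoleName → D → D → Set) → Concept → D → Set
sem dom cn rn (atom A) d = cn A d
sem dom cn rn top d = dom d
sem dom cn rn (C ⊓ E) d = sem dom cn rn C d × sem dom cn rn E d
sem dom cn rn (atLeast k _ R C) d =
  Σ (List _) λ es → length es ≡ k × Unique es ×
    All (λ e → rn R d e × sem dom cn rn C e) es

⟦_⟧ : Concept → (I : Interp) → Δ I → Set
⟦ C ⟧ I = sem (λ _ → ⊤) (conI I) (rolI I) C

-- A sub-interpretation I' ⊆ I, with Δ^{I'} ⊆ Δ^I given as a predicate on Δ^I,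
-- and X^{I'} ⊆ X^I for all names; extensions in I' lie within Δ^{I'}.
record SubInterp (I : Interp) : Set₁ where
  field
    dom  : Δ I → Set
    conS : ConceptName → Δ I → Set
    rolS : RoleName → Δ I → Δ I → Set
    conS-dom : ∀ A x → conS A x → dom x
    conS-⊆   : ∀ A x → conS A x → conI I A x
    rolS-dom : ∀ R x y → rolS R x y → dom x × dom y
    rolS-⊆   : ∀ R x y → rolS R x y → rolI I R x y
open SubInterp public

⟦_⟧ˢ : {I : Interp} → Concept → SubInterp I → Δ I → Set
⟦ C ⟧ˢ S = sem (dom S) (conS S) (rolS S) C

DomSize≤ : {I : Interp} → SubInterp I → ℕ → Set
DomSize≤ S n = Σ (List _) λ xs → length xs ≤ n × (∀ x → dom S x → x ∈ xs)

-- A satisfying element d is witnessed by a finite list of elements: d itself, the witnesses of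
-- both conjuncts, and for (≥ k R.C) the k chosen successors together with their own witnesses.
-- The sub-interpretation induced by this list still satisfies C at d, since every concept of
-- the fragment is preserved under enlarging the interpretation. The list has exactly
-- witnessCount C elements, and witnessCount C ≤ n ^ |C| for every n ≥ |C|.
module Submission where

open import Defs
open import Data.Nat using (ℕ; suc; _+_; _*_; _^_; _≤_; s≤s; z≤n)
open import Data.Nat.Properties
open import Data.List using (List; []; _∷_; _++_; length)
open import Data.List.Properties using (length-++)
open import Data.List.Relation.Unary.All using (All; []; _∷_)
open import Data.List.Relation.Unary.Any using (here; there)
open import Data.List.Membership.Propositional using (_∈_)
open import Data.List.Relation.Binary.Subset.Propositional using (_⊆_)
open import Data.List.Relation.Binary.Subset.Propositional.Properties
  using (⊆-trans; xs⊆xs++ys; xs⊆ys++xs)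
open import Data.Product using (Σ; _×_; _,_; proj₁; proj₂)
open import Function using (id; _∘_)
open import Relation.Binary.PropositionalEquality
  using (_≡_; refl; sym; cong; cong₂; subst; module ≡-Reasoning)

witnessCount : Concept → ℕ
witnessCount (atom A) = 1
witnessCount top = 1
witnessCount (C ⊓ E) = suc (witnessCount C + witnessCount E)
witnessCount (atLeast k _ R C) = suc (k * witnessCount C)

1≤size : ∀ C → 1 ≤ size C
1≤size (atom A) = ≤-refl
1≤size top = ≤-refl
1≤size (C ⊓ E) = m≤n+m 1 (size C + size E)
1≤size (atLeast k _ R C) = s≤s z≤n

suc-+-≤-^ : ∀ {n} a b {P Q} → 3 ≤ n → P ≤ n ^ a → Q ≤ n ^ b →
  suc (P + Q) ≤ n ^ (1 + (a + b))
suc-+-≤-^ {n@(suc _)} a b {P} {Q} 3≤n P≤ Q≤ = begin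
  suc (P + Q)   ≤⟨ +-mono-≤ (m^n>0 n (a + b)) (+-mono-≤ (≤-trans P≤ (^-monoʳ-≤ n (m≤m+n a b)))
                                                      (≤-trans Q≤ (^-monoʳ-≤ n (m≤n+m b a)))) ⟩
  M + (M + M)   ≡⟨ cong (λ t → M + (M + t)) (+-identityʳ M) ⟨
  3 * M         ≤⟨ *-monoˡ-≤ M 3≤n ⟩
  n * M         ∎
  where
  open ≤-Reasoning
  M : ℕ
  M = n ^ (a + b)

suc-*-≤-^ : ∀ {n} k c {L} → 1 + k + 1 + c ≤ n → L ≤ n ^ c →
  suc (k * L) ≤ n ^ (1 + k + 1 + c)
suc-*-≤-^ {n@(suc _)} k c {L} size≤n L≤ = begin
  suc (k * L)             ≤⟨ +-mono-≤ (m^n>0 n c) (*-monoʳ-≤ k L≤) ⟩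
  suc k * n ^ c           ≤⟨ *-mono-≤ (≤-trans (m≤m+n (suc k) 1) (≤-trans (m≤m+n (suc k + 1) c) size≤n))
                                       (^-monoʳ-≤ n (m≤n+m c (k + 1))) ⟩
  n * n ^ (k + 1 + c)     ∎
  where open ≤-Reasoning

witnessCount≤^size : ∀ {n} C → size C ≤ n → witnessCount C ≤ n ^ size C
witnessCount≤^size {n} (atom A) 1≤n = subst (1 ≤_) (sym (*-identityʳ n)) 1≤n
witnessCount≤^size {n} top 1≤n = subst (1 ≤_) (sym (*-identityʳ n)) 1≤n
witnessCount≤^size {n} (C ⊓ E) size≤n =
  subst (λ t → witnessCount (C ⊓ E) ≤ n ^ t) (+-comm 1 (size C + size E))
    (suc-+-≤-^ (size C) (size E) 3≤n (witnessCount≤^size C sizeC≤n)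
                                     (witnessCount≤^size E sizeE≤n))
  where
  3≤n : 3 ≤ n
  3≤n = ≤-trans (+-mono-≤ (+-mono-≤ (1≤size C) (1≤size E)) ≤-refl) size≤n
  sizeC≤n : size C ≤ n
  sizeC≤n = ≤-trans (≤-trans (m≤m+n (size C) (size E)) (m≤m+n _ 1)) size≤n
  sizeE≤n : size E ≤ n
  sizeE≤n = ≤-trans (≤-trans (m≤n+m (size E) (size C)) (m≤m+n _ 1)) size≤n
witnessCount≤^size (atLeast k _ R C) size≤n =
  suc-*-≤-^ k (size C) size≤n
    (witnessCount≤^size C (≤-trans (m≤n+m (size C) (suc k + 1)) size≤n))

module _ (I : Interp) where

  induced : List (Δ I) → SubInterp I
  induced W = record
    { dom = _∈ W
    ; conS = λ A x → x ∈ W × conI I A x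
    ; rolS = λ R x y → (x ∈ W × y ∈ W) × rolI I R x y
    ; conS-dom = λ _ _ → proj₁
    ; conS-⊆ = λ _ _ → proj₂
    ; rolS-dom = λ _ _ _ → proj₁
    ; rolS-⊆ = λ _ _ _ → proj₂
    }

  Successors : RoleName → Concept → Δ I → List (Δ I) → Set
  Successors R C d = All (λ e → rolI I R d e × ⟦ C ⟧ I e)

  mutual
    witnesses : ∀ C {d} → ⟦ C ⟧ I d → List (Δ I)
    witnesses (atom A) {d} _ = d ∷ []
    witnesses top {d} _ = d ∷ []
    witnesses (C ⊓ E) {d} (p , q) = d ∷ witnesses C p ++ witnesses E q
    witnesses (atLeast k _ R C) {d} (_ , _ , _ , ps) = d ∷ successorWitnesses C ps

    successorWitnesses : ∀ C {R d es} → Successors R C d es → List (Δ I)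
    successorWitnesses C [] = []
    successorWitnesses C ((_ , p) ∷ ps) = witnesses C p ++ successorWitnesses C ps

  ∈-witnesses : ∀ C {d} (p : ⟦ C ⟧ I d) → d ∈ witnesses C p
  ∈-witnesses (atom A) _ = here refl
  ∈-witnesses top _ = here refl
  ∈-witnesses (C ⊓ E) _ = here refl
  ∈-witnesses (atLeast k _ R C) _ = here refl

  mutual
    induced-sem : ∀ {W} C {d} (p : ⟦ C ⟧ I d) → witnesses C p ⊆ W → ⟦ C ⟧ˢ (induced W) d
    induced-sem (atom A) p ⊆W = ⊆W (here refl) , p
    induced-sem top p ⊆W = ⊆W (here refl)
    induced-sem (C ⊓ E) (p , q) ⊆W =
      induced-sem C p (⊆-trans (xs⊆xs++ys _ _) (⊆W ∘ there)) ,
      induced-sem E q (⊆-trans (xs⊆ys++xs _ (witnesses C p)) (⊆W ∘ there))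
    induced-sem (atLeast k _ R C) (es , l , u , ps) ⊆W =
      es , l , u , induced-successors C ps (⊆W (here refl)) (⊆W ∘ there)

    induced-successors : ∀ {W} C {R d es} (ps : Successors R C d es) → d ∈ W →
      successorWitnesses C ps ⊆ W → All (λ e → rolS (induced W) R d e × ⟦ C ⟧ˢ (induced W) e) es
    induced-successors C [] d∈W ⊆W = []
    induced-successors C ((r , p) ∷ ps) d∈W ⊆W =
      (((d∈W , ⊆W (xs⊆xs++ys _ _ (∈-witnesses C p))) , r) ,
       induced-sem C p (⊆W ∘ xs⊆xs++ys _ _))
      ∷ induced-successors C ps d∈W (⊆W ∘ xs⊆ys++xs _ (witnesses C p))

  mutual
    length-witnesses : ∀ C {d} (p : ⟦ C ⟧ I d) → length (witnesses C p) ≡ witnessCount C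
    length-witnesses (atom A) _ = refl
    length-witnesses top _ = refl
    length-witnesses (C ⊓ E) (p , q) = cong suc (begin
      length (witnesses C p ++ witnesses E q)         ≡⟨ length-++ (witnesses C p) ⟩
      length (witnesses C p) + length (witnesses E q) ≡⟨ cong₂ _+_ (length-witnesses C p)
                                                                (length-witnesses E q) ⟩
      witnessCount C + witnessCount E                 ∎)
      where open ≡-Reasoning
    length-witnesses (atLeast k _ R C) (es , l , _ , ps) = cong suc (begin
      length (successorWitnesses C ps) ≡⟨ length-successorWitnesses C ps ⟩
      length es * witnessCount C       ≡⟨ cong (_* witnessCount C) l ⟩
      k * witnessCount C               ∎)
      where open ≡-Reasoning

    length-successorWitnesses : ∀ C {R d es} (ps : Successors R C d es) →
      length (successorWitnesses C ps) ≡ length es * witnessCount C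
    length-successorWitnesses C [] = refl
    length-successorWitnesses C {es = e ∷ es} ((_ , p) ∷ ps) = begin
      length (witnesses C p ++ successorWitnesses C ps)         ≡⟨ length-++ (witnesses C p) ⟩
      length (witnesses C p) + length (successorWitnesses C ps) ≡⟨ cong₂ _+_ (length-witnesses C p)
                                                                          (length-successorWitnesses C ps) ⟩
      witnessCount C + length es * witnessCount C               ∎
      where open ≡-Reasoning

lemma1 : (C : Concept) (I : Interp) (d : Δ I) → ⟦ C ⟧ I d →
    Σ (SubInterp I) λ I' → ⟦ C ⟧ˢ I' d × DomSize≤ I' (size C ^ size C)
lemma1 C I d p = induced I W , induced-sem I C p id , W , length-W≤ , λ _ → id
  where
  W : List (Δ I)
  W = witnesses I C p
  length-W≤ : length W ≤ size C ^ size C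
  length-W≤ = begin
    length W           ≡⟨ length-witnesses I C p ⟩
    witnessCount C     ≤⟨ witnessCount≤^size C ≤-refl ⟩
    size C ^ size C    ∎
    where open ≤-Reasoning
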